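{- There is a constant $c>0$ such that for every $n$ there exists an interval graph $G$ on $n$ vertices with $\mathrm{sd}(G)\ge c\sqrt[4]{n}$.
   Context: An interval graph is the intersection graph of a finite family of intervals on the real line. For a graph $G$ and distinct vertices $u,v$, $\mathrm{sd}_G(u,v)$ is the number of vertices other than $u,v$ that are adjacent to exactly one of $u$ and $v$. The symmetric difference of $G$ is $\mathrm{sd}(G)=\max_H \min_{u\ne v\in V(H)} \mathrm{sd}_H(u,v)$, the maximum taken over all induced subgraphs $H$ of $G$ with at least two vertices. -}

module Defs where

open import Data.Nat using (ℕ; zero; suc; _⊔_; _⊓_; _≤ᵇ_)
open import Data.Bool using (Bool; true; false; _∧_; not; _xor_; if_then_else_)
open import Data.Fin using (Fin; zero; suc)
import Data.Fin as Fin
open import Data.Vec using (Vec; []; _∷_; lookup)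
open import Data.List using (List; []; _∷_; map; concatMap; foldr; allFin; _++_)
open import Data.Nat.ListAction using (sum)
open import Data.Rational using (ℚ; _≤_)
open import Data.Product using (Σ; _×_; _,_)
open import Relation.Nullary using (does; ¬_)
open import Relation.Binary.PropositionalEquality using (_≡_)
open import Function.Bundles using (_⇔_)

record Graph (n : ℕ) : Set where
  field
    adj   : Fin n → Fin n → Bool
    sym   : ∀ u v → adj u v ≡ adj v u
    irrefl : ∀ u → adj u u ≡ false
open Graph public

IsIntervalGraph : ∀ {n} → Graph n → Set
IsIntervalGraph {n} G =
  Σ (Fin n → ℚ) λ l → Σ (Fin n → ℚ) λ r →
    (∀ i → l i ≤ r i) ×
    (∀ i j → ¬ (i ≡ j) → ((adj G i j ≡ true) ⇔ ((l i ≤ r j) × (l j ≤ r i))))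

Subset : ℕ → Set
Subset n = Vec Bool n

allSubsets : ∀ n → List (Subset n)
allSubsets zero = [] ∷ []
allSubsets (suc n) = map (true ∷_) (allSubsets n) ++ map (false ∷_) (allSubsets n)

_==_ : ∀ {n} → Fin n → Fin n → Bool
u == v = does (u Fin.≟ v)

count : ∀ {n} → (Fin n → Bool) → ℕ
count {n} p = sum (map (λ w → if p w then 1 else 0) (allFin n))

size : ∀ {n} → Subset n → ℕ
size S = count (lookup S)

sdIn : ∀ {n} → Graph n → Subset n → Fin n → Fin n → ℕ
sdIn G S u v = count (λ w → lookup S w ∧ not (w == u) ∧ not (w == v) ∧ (adj G u w xor adj G v w))

pairValues : ∀ {n} → Graph n → Subset n → List ℕ
pairValues {n} G S =
  concatMap (λ u → concatMap (λ v →
     if lookup S u ∧ lookup S v ∧ not (u == v) then sdIn G S u v ∷ [] else [])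
     (allFin n)) (allFin n)

-- min over u ≠ v of sd_H(u,v); the default n is never used when |H| ≥ 2.
minSd : ∀ {n} → Graph n → Subset n → ℕ
minSd {n} G S = foldr _⊓_ n (pairValues G S)

sd : ∀ {n} → Graph n → ℕ
sd {n} G = foldr _⊔_ 0
  (concatMap (λ S → if 2 ≤ᵇ size S then minSd G S ∷ [] else []) (allSubsets n))

-- Take k ≥ 2, N = k * k + 1 and M = k * N, and consider the points 0 , … , M - 2 and
-- M + 1 , … , 2M - 1 together with the k * M intervals [a , M + h(a,t)], a < M, t < k, where
-- h(a,t) = (k * a mod N) + t * N. In the interval graph of these about k⁴ vertices any two
-- are distinguished by k others. Two points, or a point and an interval, are separated by a
-- run of k consecutive points or of k intervals sharing a left end or a height; such runs
-- exist because every height below M is attained by k intervals with left ends u + j * N.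
-- Two intervals are separated by the points between their left ends and between their right
-- ends, and there are at least k of those because h(a,t) ≡ k * a (mod N) and k * k < N.

module Submission where

open import Defs hiding (sym)
open import Data.Bool using (Bool; true; false; _∧_; not; _xor_; if_then_else_)
open import Data.Bool.Properties using (∧-comm; ∧-zeroʳ; T-≡)
open import Data.Empty using (⊥-elim)
open import Data.Fin using (Fin; zero; suc; toℕ)
import Data.Fin as Fin
open import Data.Fin.Properties using (toℕ-injective)
open import Data.Integer using (+≤+)
import Data.Integer as ℤ
import Data.Integer.Properties as ℤ
open import Data.List using ([]; _∷_; map; allFin)
open import Data.List.Membership.Propositional using (_∈_; lose)
open import Data.List.Membership.Propositional.Properties using (∈-++⁺ˡ; ∈-++⁺ʳ; ∈-map⁺)
open import Data.List.Properties using (map-tabulate; map-cong; foldr-preservesᵇ; foldr-preservesᵒ)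
open import Data.List.Relation.Unary.All using (All; []; _∷_)
import Data.List.Relation.Unary.All.Properties as All
open import Data.List.Relation.Unary.Any using (Any; here)
import Data.List.Relation.Unary.Any.Properties as Any
open import Data.Nat
open import Data.Nat.DivMod
open import Data.Nat.Tactic.RingSolver using (solve-∀)
open import Data.Nat.Divisibility using (∣1⇒≡1)
open import Data.Nat.ListAction using (sum)
open import Data.Nat.Properties
open import Data.Product using (Σ; _×_; _,_; proj₁; proj₂)
open import Data.Rational using (ℚ; mkℚ; *≤*)
import Data.Rational as ℚ
open import Data.Sum using (_⊎_; inj₁; inj₂)
open import Data.Vec using (lookup; []; _∷_)
import Data.Vec as Vec
open import Data.Vec.Properties using (lookup∘tabulate)
open import Function using (_∘_; mk⇔; Equivalence)
open import Relation.Binary.PropositionalEquality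
open import Relation.Nullary using (¬_; Dec; yes; no; does)
open import Relation.Binary.Definitions using (tri<; tri≈; tri>)
open import Relation.Nullary.Decidable using (_×-dec_; dec-true)

indicator : Bool → ℕ
indicator b = if b then 1 else 0

count-cong : ∀ {n} {p q : Fin n → Bool} → (∀ w → p w ≡ q w) → count p ≡ count q
count-cong {n} p≗q = cong sum (map-cong (cong indicator ∘ p≗q) (allFin n))

count-suc : ∀ {n} (p : Fin (suc n) → Bool) → count p ≡ indicator (p zero) + count (p ∘ suc)
count-suc {n} p = cong (indicator (p zero) +_)
  (cong sum (trans (map-tabulate suc (indicator ∘ p)) (sym (map-tabulate (λ i → i) (indicator ∘ p ∘ suc)))))

countBelow : ℕ → (ℕ → Bool) → ℕ
countBelow zero    Q = 0
countBelow (suc n) Q = countBelow n Q + indicator (Q n)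

countBelow-suc : ∀ n Q → countBelow (suc n) Q ≡ indicator (Q 0) + countBelow n (Q ∘ suc)
countBelow-suc zero    Q = +-comm 0 (indicator (Q 0))
countBelow-suc (suc n) Q = begin
  countBelow (suc n) Q + indicator (Q (suc n))
    ≡⟨ cong (_+ indicator (Q (suc n))) (countBelow-suc n Q) ⟩
  indicator (Q 0) + countBelow n (Q ∘ suc) + indicator (Q (suc n))
    ≡⟨ +-assoc (indicator (Q 0)) _ _ ⟩
  indicator (Q 0) + countBelow (suc n) (Q ∘ suc)
    ∎
  where open ≡-Reasoning

count-toℕ : ∀ n Q → count {n} (Q ∘ toℕ) ≡ countBelow n Q
count-toℕ zero    Q = refl
count-toℕ (suc n) Q = trans (count-suc {n} (Q ∘ toℕ))
  (trans (cong (indicator (Q 0) +_) (count-toℕ n (Q ∘ suc))) (sym (countBelow-suc n Q)))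

countBelow-mono : ∀ Q {m n} → m ≤ n → countBelow m Q ≤ countBelow n Q
countBelow-mono Q {n = zero}  z≤n = ≤-refl
countBelow-mono Q {n = suc n} m≤1+n with m≤n⇒m<n∨m≡n m≤1+n
... | inj₁ m<1+n = ≤-trans (countBelow-mono Q (≤-pred m<1+n)) (m≤m+n _ _)
... | inj₂ refl  = ≤-refl

IncreasingBelow : ℕ → (ℕ → ℕ) → Set
IncreasingBelow k h = ∀ j → suc j < k → h j < h (suc j)

increasing⇒< : ∀ {k h} → IncreasingBelow k h → ∀ {i j} → i < j → j < k → h i < h j
increasing⇒< inc {i} {suc j} (s≤s i≤j) 1+j<k with m≤n⇒m<n∨m≡n i≤j
... | inj₁ i<j  = <-trans (increasing⇒< inc i<j (<-trans (n<1+n j) 1+j<k)) (inc j 1+j<k)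
... | inj₂ refl = inc j 1+j<k

countBelow-≥ : ∀ k n Q (h : ℕ → ℕ) → IncreasingBelow k h →
  (∀ j → j < k → h j < n × Q (h j) ≡ true) → k ≤ countBelow n Q
countBelow-≥ zero    n Q h inc hits = z≤n
countBelow-≥ (suc k) n Q h inc hits = begin
  suc k                                     ≡⟨ +-comm 1 k ⟩
  k + 1                                     ≤⟨ +-monoˡ-≤ 1 (countBelow-≥ k (h k) Q h inc′ hits′) ⟩
  countBelow (h k) Q + 1                    ≡⟨ cong (λ b → countBelow (h k) Q + indicator b) (sym Qhk) ⟩
  countBelow (suc (h k)) Q                  ≤⟨ countBelow-mono Q hk<n ⟩
  countBelow n Q                            ∎
  where
  open ≤-Reasoning
  hk<n = proj₁ (hits k ≤-refl)
  Qhk = proj₂ (hits k ≤-refl)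
  inc′ : IncreasingBelow k h
  inc′ j 1+j<k = inc j (<-trans 1+j<k (n<1+n k))
  hits′ : ∀ j → j < k → h j < h k × Q (h j) ≡ true
  hits′ j j<k = increasing⇒< inc j<k (n<1+n k) , proj₂ (hits j (<-trans j<k (n<1+n k)))

count-≥ : ∀ k n Q (h : ℕ → ℕ) → IncreasingBelow k h →
  (∀ j → j < k → h j < n × Q (h j) ≡ true) → k ≤ count {n} (Q ∘ toℕ)
count-≥ k n Q h inc hits = subst (k ≤_) (sym (count-toℕ n Q)) (countBelow-≥ k n Q h inc hits)

∈-allSubsets : ∀ n (S : Subset n) → S ∈ allSubsets n
∈-allSubsets zero    []          = here refl
∈-allSubsets (suc n) (true ∷ S)  = ∈-++⁺ˡ (∈-map⁺ (true ∷_) (∈-allSubsets n S))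
∈-allSubsets (suc n) (false ∷ S) =
  ∈-++⁺ʳ (map (true ∷_) (allSubsets n)) (∈-map⁺ (false ∷_) (∈-allSubsets n S))

minSd≤sd : ∀ {n} (G : Graph n) (S : Subset n) → 2 ≤ size S → minSd G S ≤ sd G
minSd≤sd {n} G S 2≤|S| =
  foldr-preservesᵒ ≤⊔ 0 _ (inj₂ (Any.concat⁺ (Any.map⁺ (lose (∈-allSubsets n S) candidate))))
  where
  ≤⊔ : ∀ x y → minSd G S ≤ x ⊎ minSd G S ≤ y → minSd G S ≤ x ⊔ y
  ≤⊔ x y (inj₁ p) = m≤n⇒m≤n⊔o y p
  ≤⊔ x y (inj₂ p) = m≤n⇒m≤o⊔n x p
  candidate : Any (minSd G S ≤_) (if 2 ≤ᵇ size S then minSd G S ∷ [] else [])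
  candidate rewrite T-≡ .Equivalence.to (≤⇒≤ᵇ 2≤|S|) = here ≤-refl

sd-≥ : ∀ {n} (G : Graph n) (S : Subset n) k → 2 ≤ size S → k ≤ n →
  (∀ u v → lookup S u ≡ true → lookup S v ≡ true → u ≢ v → k ≤ sdIn G S u v) → k ≤ sd G
sd-≥ {n} G S k 2≤|S| k≤n separated = ≤-trans k≤minSd (minSd≤sd G S 2≤|S|)
  where
  pair : ∀ u v → All (k ≤_) (if lookup S u ∧ lookup S v ∧ not (u == v) then sdIn G S u v ∷ [] else [])
  pair u v with lookup S u in Su | lookup S v in Sv | u Fin.≟ v
  ... | true  | true  | no u≢v = separated u v Su Sv u≢v ∷ []
  ... | true  | true  | yes _  = []
  ... | true  | false | _      = []
  ... | false | _     | _      = []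
  k≤minSd : k ≤ minSd G S
  k≤minSd = foldr-preservesᵇ ⊓-glb k≤n
    (All.concat⁺ (All.map⁺ (All.tabulate⁺ λ u → All.concat⁺ (All.map⁺ (All.tabulate⁺ (pair u))))))

ℕ→ℚ : ℕ → ℚ
ℕ→ℚ n = mkℚ (ℤ.+ n) 0 (λ {d} d∣n×d∣1 → ∣1⇒≡1 (proj₂ d∣n×d∣1))

ℕ→ℚ-mono-≤ : ∀ {m n} → m ≤ n → ℕ→ℚ m ℚ.≤ ℕ→ℚ n
ℕ→ℚ-mono-≤ {m} {n} m≤n =
  *≤* (subst₂ ℤ._≤_ (sym (ℤ.*-identityʳ (ℤ.+ m))) (sym (ℤ.*-identityʳ (ℤ.+ n))) (+≤+ m≤n))

ℕ→ℚ-cancel-≤ : ∀ {m n} → ℕ→ℚ m ℚ.≤ ℕ→ℚ n → m ≤ n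
ℕ→ℚ-cancel-≤ {m} {n} (*≤* p) =
  ℤ.drop‿+≤+ (subst₂ ℤ._≤_ (ℤ.*-identityʳ (ℤ.+ m)) (ℤ.*-identityʳ (ℤ.+ n)) p)

≡ᵇ-sym : ∀ i j → (i ≡ᵇ j) ≡ (j ≡ᵇ i)
≡ᵇ-sym zero    zero    = refl
≡ᵇ-sym zero    (suc j) = refl
≡ᵇ-sym (suc i) zero    = refl
≡ᵇ-sym (suc i) (suc j) = ≡ᵇ-sym i j

≡ᵇ-refl : ∀ i → (i ≡ᵇ i) ≡ true
≡ᵇ-refl i = T-≡ .Equivalence.to (≡⇒≡ᵇ i i refl)

≢⇒≡ᵇ-false : ∀ {i j} → i ≢ j → (i ≡ᵇ j) ≡ false
≢⇒≡ᵇ-false {i} {j} i≢j with i ≡ᵇ j in eq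
... | true  = ⊥-elim (i≢j (≡ᵇ⇒≡ i j (T-≡ .Equivalence.from eq)))
... | false = refl

module IntervalGraph (L R : ℕ → ℕ) where

  meets : ℕ → ℕ → Bool
  meets i j = not (i ≡ᵇ j) ∧ ((L i ≤ᵇ R j) ∧ (L j ≤ᵇ R i))

  meets-sym : ∀ i j → meets i j ≡ meets j i
  meets-sym i j rewrite ≡ᵇ-sym i j | ∧-comm (L i ≤ᵇ R j) (L j ≤ᵇ R i) = refl

  meets-irrefl : ∀ i → meets i i ≡ false
  meets-irrefl i rewrite ≡ᵇ-refl i = refl

  meets-true : ∀ {i j} → i ≢ j → L i ≤ R j → L j ≤ R i → meets i j ≡ true
  meets-true {i} {j} i≢j p q
    rewrite ≢⇒≡ᵇ-false i≢j | T-≡ .Equivalence.to (≤⇒≤ᵇ p) | T-≡ .Equivalence.to (≤⇒≤ᵇ q) = refl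

  meets-false : ∀ {i j} → R j < L i ⊎ R i < L j → meets i j ≡ false
  meets-false {i} {j} disjoint with L i ≤ᵇ R j in p | L j ≤ᵇ R i in q
  ... | false | _     = ∧-zeroʳ (not (i ≡ᵇ j))
  ... | true  | false = ∧-zeroʳ (not (i ≡ᵇ j))
  ... | true  | true  with disjoint
  ...   | inj₁ Rj<Li = ⊥-elim (<⇒≱ Rj<Li (≤ᵇ⇒≤ _ _ (T-≡ .Equivalence.from p)))
  ...   | inj₂ Ri<Lj = ⊥-elim (<⇒≱ Ri<Lj (≤ᵇ⇒≤ _ _ (T-≡ .Equivalence.from q)))

  meets⇒overlap : ∀ i j → meets i j ≡ true → L i ≤ R j × L j ≤ R i
  meets⇒overlap i j eq with i ≡ᵇ j | L i ≤ᵇ R j in p | L j ≤ᵇ R i in q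
  meets⇒overlap i j () | true  | _     | _
  meets⇒overlap i j () | false | false | _
  meets⇒overlap i j () | false | true  | false
  ... | false | true | true = ≤ᵇ⇒≤ _ _ (T-≡ .Equivalence.from p) , ≤ᵇ⇒≤ _ _ (T-≡ .Equivalence.from q)

  graph : ∀ n → Graph n
  graph n = record
    { adj    = λ u v → meets (toℕ u) (toℕ v)
    ; sym    = λ u v → meets-sym (toℕ u) (toℕ v)
    ; irrefl = λ u → meets-irrefl (toℕ u)
    }

  graph-isInterval : (∀ i → L i ≤ R i) → ∀ n → IsIntervalGraph (graph n)
  graph-isInterval L≤R n =
    ℕ→ℚ ∘ L ∘ toℕ , ℕ→ℚ ∘ R ∘ toℕ , ℕ→ℚ-mono-≤ ∘ L≤R ∘ toℕ , λ u v u≢v → mk⇔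
      (λ uv → let (p , q) = meets⇒overlap (toℕ u) (toℕ v) uv in ℕ→ℚ-mono-≤ p , ℕ→ℚ-mono-≤ q)
      (λ (p , q) → meets-true (u≢v ∘ toℕ-injective) (ℕ→ℚ-cancel-≤ p) (ℕ→ℚ-cancel-≤ q))

  distinguishes : (ℕ → Bool) → ℕ → ℕ → ℕ → Bool
  distinguishes chosen i j w = chosen w ∧ not (w ≡ᵇ i) ∧ not (w ≡ᵇ j) ∧ (meets i w xor meets j w)

  sdIn-graph : ∀ {n} chosen (u v : Fin n) →
    sdIn (graph n) (Vec.tabulate (chosen ∘ toℕ)) u v ≡ count {n} (distinguishes chosen (toℕ u) (toℕ v) ∘ toℕ)
  sdIn-graph {n} chosen u v = count-cong {n} λ w → cong₂ (λ c e → c ∧ e)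
      (lookup∘tabulate (chosen ∘ toℕ) w)
      (cong₂ (λ a b → not a ∧ not b ∧ (meets (toℕ u) (toℕ w) xor meets (toℕ v) (toℕ w)))
        (==-toℕ w u) (==-toℕ w v))
    where
    ==-toℕ : ∀ {n} (w u : Fin n) → (w == u) ≡ (toℕ w ≡ᵇ toℕ u)
    ==-toℕ w u with w Fin.≟ u
    ... | yes refl = sym (≡ᵇ-refl (toℕ w))
    ... | no w≢u   = sym (≢⇒≡ᵇ-false (w≢u ∘ toℕ-injective))

m*[n%o]%o≡m*n%o : ∀ m n d .{{_ : NonZero d}} → (m * (n % d)) % d ≡ (m * n) % d
m*[n%o]%o≡m*n%o m n d = begin
  (m * (n % d)) % d             ≡⟨ %-distribˡ-* m (n % d) d ⟩
  ((m % d) * (n % d % d)) % d   ≡⟨ cong (λ r → ((m % d) * r) % d) (m%n%n≡m%n n d) ⟩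
  ((m % d) * (n % d)) % d       ≡⟨ %-distribˡ-* m n d ⟨
  (m * n) % d                   ∎
  where open ≡-Reasoning

quotient-unique : ∀ d .{{_ : NonZero d}} {e f} A B → e < d → f < d →
                  e + A * d ≡ f + B * d → e ≡ f × A ≡ B
quotient-unique d {e} {f} A B e<d f<d eq =
  e≡f , *-cancelʳ-≡ A B d (+-cancelˡ-≡ e _ _ (trans eq (cong (_+ B * d) (sym e≡f))))
  where
  open ≡-Reasoning
  e≡f : e ≡ f
  e≡f = begin
    e               ≡⟨ m<n⇒m%n≡m e<d ⟨
    e % d           ≡⟨ [m+kn]%n≡m%n e A d ⟨
    (e + A * d) % d ≡⟨ cong (_% d) eq ⟩
    (f + B * d) % d ≡⟨ [m+kn]%n≡m%n f B d ⟩
    f % d           ≡⟨ m<n⇒m%n≡m f<d ⟩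
    f               ∎

module Construction (k₂ : ℕ) where

  k N M : ℕ
  k = 2 + k₂
  N = suc (k * k)
  M = k * N

  height : ℕ → ℕ → ℕ
  height a t = (k * a) % N + t * N

  k<N : k < N
  k<N = s≤s (m≤m*n k k)

  N≤M : N ≤ M
  N≤M = m≤m+n N (suc k₂ * N)

  k<M : k < M
  k<M = <-≤-trans k<N N≤M

  height<M : ∀ a {t} → t < k → height a t < M
  height<M a {t} t<k = ≤-trans (+-monoˡ-< (t * N) (m%n<n (k * a) N)) (*-monoˡ-≤ N t<k)

  height-top : ∀ a → suc k₂ * N ≤ height a (suc k₂)
  height-top a = m≤n+m (suc k₂ * N) ((k * a) % N)

  height-bottom : ∀ a → height a 0 < N
  height-bottom a = subst (_< N) (sym (+-identityʳ _)) (m%n<n (k * a) N)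

  height-0< : ∀ a {y} → suc k₂ * N < y → height a 0 < y
  height-0< a top<y = <-trans (<-≤-trans (height-bottom a) (m≤m+n N (k₂ * N))) top<y

  height-multiple : ∀ j → height (j * N) 0 ≡ 0
  height-multiple j = trans (+-identityʳ _) (trans (cong (_% N) (sym (*-assoc k j N))) (m*n%n≡0 (k * j) N))

  height-periodic : ∀ a j t → height (a + j * N) t ≡ height a t
  height-periodic a j t = cong (_+ t * N) (begin
    (k * (a + j * N)) % N      ≡⟨ cong (_% N) (*-distribˡ-+ k a (j * N)) ⟩
    (k * a + k * (j * N)) % N  ≡⟨ cong (λ x → (k * a + x) % N) (*-assoc k j N) ⟨
    (k * a + k * j * N) % N    ≡⟨ [m+kn]%n≡m%n (k * a) (k * j) N ⟩
    (k * a) % N                ∎)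
    where open ≡-Reasoning

  height-injectiveʳ : ∀ a {t t'} → height a t ≡ height a t' → t ≡ t'
  height-injectiveʳ a {t} {t'} eq = proj₂ (quotient-unique N t t' (m%n<n (k * a) N) (m%n<n (k * a) N) eq)

  height-spec : ∀ a t → height a t + (k * a / N) * N ≡ k * a + t * N
  height-spec a t = begin
    (k * a) % N + t * N + (k * a / N) * N   ≡⟨ swap ((k * a) % N) (t * N) _ ⟩
    (k * a) % N + (k * a / N) * N + t * N   ≡⟨ cong (_+ t * N) (m≡m%n+[m/n]*n (k * a) N) ⟨
    k * a + t * N                           ∎
    where
    open ≡-Reasoning
    swap : ∀ x y z → x + y + z ≡ x + z + y
    swap = solve-∀

  -- kInv = N - k is both the inverse of k and -k modulo N, as k * k ≡ -1.
  kInv : ℕ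
  kInv = k + suc k₂ * suc k₂

  kInv+k≡N : kInv + k ≡ N
  kInv+k≡N = expand k₂
    where
    expand : ∀ x → (2 + x + suc x * suc x) + (2 + x) ≡ suc ((2 + x) * (2 + x))
    expand = solve-∀

  kInv<N : kInv < N
  kInv<N = subst (kInv <_) kInv+k≡N (m<m+n kInv z<s)

  residue-attained : ∀ r → r < N → Σ ℕ λ u → u < N × (k * u) % N ≡ r
  residue-attained r r<N = (kInv * r) % N , m%n<n (kInv * r) N , (begin
    (k * ((kInv * r) % N)) % N   ≡⟨ m*[n%o]%o≡m*n%o k (kInv * r) N ⟩
    (k * (kInv * r)) % N         ≡⟨ cong (_% N) (inverse k₂ r) ⟩
    (r + suc k₂ * r * N) % N     ≡⟨ [m+kn]%n≡m%n r (suc k₂ * r) N ⟩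
    r % N                        ≡⟨ m<n⇒m%n≡m r<N ⟩
    r                            ∎)
    where
    open ≡-Reasoning
    inverse : ∀ x r → (2 + x) * ((2 + x + suc x * suc x) * r) ≡ r + suc x * r * suc ((2 + x) * (2 + x))
    inverse = solve-∀

  height-attains : ∀ y → y < M → Σ ℕ λ u → Σ ℕ λ t → u < N × t < k × (∀ j → height (u + j * N) t ≡ y)
  height-attains y y<M with residue-attained (y % N) (m%n<n y N)
  ... | u , u<N , ku≡y = u , y / N , u<N , m<n*o⇒m/o<n y<M , λ j → begin
    height (u + j * N) (y / N)   ≡⟨ height-periodic u j (y / N) ⟩
    (k * u) % N + y / N * N      ≡⟨ cong (_+ y / N * N) ku≡y ⟩
    y % N + y / N * N            ≡⟨ m≡m%n+[m/n]*n y N ⟨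
    y                            ∎
    where open ≡-Reasoning

  last : ℕ
  last = M ∸ 1

  k≤height-last : ∀ t → k ≤ height last t
  k≤height-last t = begin
    k                                         ≤⟨ m≤m+n k (suc k₂ * suc k₂) ⟩
    kInv                                      ≡⟨ m<n⇒m%n≡m kInv<N ⟨
    kInv % N                                  ≡⟨ [m+kn]%n≡m%n kInv (k₂ * k₂ + 4 * k₂ + 3) N ⟨
    (kInv + (k₂ * k₂ + 4 * k₂ + 3) * N) % N   ≡⟨ cong (_% N) (k*last k₂) ⟨
    (k * last) % N                            ≤⟨ m≤m+n _ (t * N) ⟩
    height last t                             ∎
    where
    open ≤-Reasoning
    k*last : ∀ x → (2 + x) * ((2 + x) * (2 + x) + suc x * suc ((2 + x) * (2 + x)))
                 ≡ (2 + x + suc x * suc x) + (x * x + 4 * x + 3) * suc ((2 + x) * (2 + x))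
    k*last = solve-∀

  height-rise : ∀ a d {t t'} e → height a t + e ≡ height (a + d) t' →
                e + (t + k * (a + d) / N) * N ≡ k * d + (t' + k * a / N) * N
  height-rise a d {t} {t'} e rise = +-cancelʳ-≡ (k * a) _ _ (begin
    e + (t + q′) * N + k * a                   ≡⟨ r₁ e t q′ N (k * a) ⟩
    k * a + t * N + e + q′ * N                 ≡⟨ cong (λ x → x + e + q′ * N) (height-spec a t) ⟨
    height a t + q * N + e + q′ * N            ≡⟨ r₂ (height a t) q N e q′ ⟩
    height a t + e + q′ * N + q * N            ≡⟨ cong (λ x → x + q′ * N + q * N) rise ⟩
    height (a + d) t' + q′ * N + q * N         ≡⟨ cong (_+ q * N) (height-spec (a + d) t') ⟩
    k * (a + d) + t' * N + q * N               ≡⟨ r₃ k a d t' N q ⟩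
    k * d + (t' + q) * N + k * a               ∎)
    where
    open ≡-Reasoning
    q  = k * a / N
    q′ = k * (a + d) / N
    r₁ : ∀ e t q′ n ka → e + (t + q′) * n + ka ≡ ka + t * n + e + q′ * n
    r₁ = solve-∀
    r₂ : ∀ h q n e q′ → h + q * n + e + q′ * n ≡ h + e + q′ * n + q * n
    r₂ = solve-∀
    r₃ : ∀ k a d t′ n q → k * (a + d) + t′ * n + q * n ≡ k * d + (t′ + q) * n + k * a
    r₃ = solve-∀

  height-drop : ∀ a d {t t'} e → height (a + d) t' + e ≡ height a t →
                k * d + e + (t' + k * a / N) * N ≡ 0 + (t + k * (a + d) / N) * N
  height-drop a d {t} {t'} e drop = +-cancelʳ-≡ (k * a) _ _ (begin
    k * d + e + (t' + q) * N + k * a            ≡⟨ r₁ k a d e t' N q ⟩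
    k * (a + d) + t' * N + e + q * N            ≡⟨ cong (λ x → x + e + q * N) (height-spec (a + d) t') ⟨
    height (a + d) t' + q′ * N + e + q * N      ≡⟨ r₂ (height (a + d) t') q′ N e q ⟩
    height (a + d) t' + e + q * N + q′ * N      ≡⟨ cong (λ x → x + q * N + q′ * N) drop ⟩
    height a t + q * N + q′ * N                 ≡⟨ cong (_+ q′ * N) (height-spec a t) ⟩
    k * a + t * N + q′ * N                      ≡⟨ r₃ (k * a) t N q′ ⟩
    0 + (t + q′) * N + k * a                    ∎)
    where
    open ≡-Reasoning
    q  = k * a / N
    q′ = k * (a + d) / N
    r₁ : ∀ k a d e t′ n q → k * d + e + (t′ + q) * n + k * a ≡ k * (a + d) + t′ * n + e + q * n
    r₁ = solve-∀
    r₂ : ∀ h q′ n e q → h + q′ * n + e + q * n ≡ h + e + q * n + q′ * n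
    r₂ = solve-∀
    r₃ : ∀ ka t n q′ → ka + t * n + q′ * n ≡ 0 + (t + q′) * n + ka
    r₃ = solve-∀

  -- The points (a , height a t) are pairwise at ℓ¹-distance at least k: by the two lemmas above
  -- a horizontal step d changes the height by ± k * d modulo N, and k * k < N.
  far-above : ∀ a d {t t'} → ¬ (d ≡ 0 × t ≡ t') → height a t ≤ height (a + d) t' →
              k ≤ d + (height (a + d) t' ∸ height a t)
  far-above a d {t} {t'} different below = ≮⇒≥ λ close → different (same close)
    where
    e    = height (a + d) t' ∸ height a t
    rise = m+[n∸m]≡n below
    same : d + e < k → d ≡ 0 × t ≡ t'
    same close with quotient-unique N (t + k * (a + d) / N) (t' + k * a / N) e<N kd<N
                                    (height-rise a d {t} {t'} e rise)
      where
      e<N  = <-trans (≤-<-trans (m≤n+m e d) close) k<N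
      kd<N = <-trans (*-monoʳ-< k (≤-<-trans (m≤m+n d e) close)) (n<1+n (k * k))
    same close | e≡kd , _ with d ≟ 0
    ... | no d≢0 = ⊥-elim (<⇒≱ close
      (≤-trans (m≤m*n k d {{≢-nonZero d≢0}}) (≤-trans (≤-reflexive (sym e≡kd)) (m≤n+m e d))))
    ... | yes d≡0 = d≡0 , height-injectiveʳ a (begin
      height a t            ≡⟨ +-identityʳ (height a t) ⟨
      height a t + 0        ≡⟨ cong (height a t +_) (trans e≡kd (trans (cong (k *_) d≡0) (*-zeroʳ k))) ⟨
      height a t + e        ≡⟨ rise ⟩
      height (a + d) t'     ≡⟨ cong (λ b → height b t') (trans (cong (a +_) d≡0) (+-identityʳ a)) ⟩
      height a t'           ∎)
      where open ≡-Reasoning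

  far-below : ∀ a d {t t'} → height (a + d) t' < height a t → k ≤ d + (height a t ∸ height (a + d) t')
  far-below a d {t} {t'} above = ≮⇒≥ λ close → m<n⇒n≢0 (m<n⇒0<n∸m above) (flat close)
    where
    e = height a t ∸ height (a + d) t'
    flat : d + e < k → e ≡ 0
    flat close = m+n≡0⇒n≡0 (k * d) (proj₁ (quotient-unique N (t' + k * a / N) (t + k * (a + d) / N) small z<s
                                             (height-drop a d {t} {t'} e (m+[n∸m]≡n (<⇒≤ above)))))
      where
      small : k * d + e < N
      small = ≤-<-trans (+-monoʳ-≤ (k * d) (m≤n*m e k))
                (≤-<-trans (≤-reflexive (sym (*-distribˡ-+ k d e))) (<-trans (*-monoʳ-< k close) (n<1+n (k * k))))

  slots : ℕ
  slots = M + M + k * M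

  -- X x is the point x, Y y the point M + y, and Z a t the interval [a , M + height a t].
  -- Graph vertices are numbered by slot; numbers past slots become further isolated points.
  data Vertex : Set where
    X : ℕ → Vertex
    Y : ℕ → Vertex
    Z : ℕ → ℕ → Vertex

  left right slot : Vertex → ℕ
  left (X x)    = x
  left (Y y)    = M + y
  left (Z a t)  = a
  right (X x)   = x
  right (Y y)   = M + y
  right (Z a t) = M + height a t
  slot (X x)    = x
  slot (Y y)    = M + y
  slot (Z a t)  = M + M + (t + a * k)

  -- The points M - 1 and M are left out, so that the intervals Z last t miss every X point
  -- and the intervals Z (j * N) 0 miss every Y point.
  Valid : Vertex → Set
  Valid (X x)   = suc x < M
  Valid (Y y)   = 0 < y × y < M
  Valid (Z a t) = a < M × t < k

  valid? : ∀ v → Dec (Valid v)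
  valid? (X x)   = suc x <? M
  valid? (Y y)   = (0 <? y) ×-dec (y <? M)
  valid? (Z a t) = (a <? M) ×-dec (t <? k)

  vertexAt : ℕ → Vertex
  vertexAt i with i <? M
  ... | yes _ = X i
  ... | no _ with i <? M + M
  ...   | yes _ = Y (i ∸ M)
  ...   | no _ with i <? slots
  ...     | yes _ = Z ((i ∸ (M + M)) / k) ((i ∸ (M + M)) % k)
  ...     | no _  = X i

  slot-vertexAt : ∀ i → slot (vertexAt i) ≡ i
  slot-vertexAt i with i <? M
  ... | yes _ = refl
  ... | no i≮M with i <? M + M
  ...   | yes _ = m+[n∸m]≡n (≮⇒≥ i≮M)
  ...   | no i≮2M with i <? slots
  ...     | no _  = refl
  ...     | yes _ = begin
    M + M + ((i ∸ (M + M)) % k + (i ∸ (M + M)) / k * k)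
      ≡⟨ cong (M + M +_) (m≡m%n+[m/n]*n (i ∸ (M + M)) k) ⟨
    M + M + (i ∸ (M + M))
      ≡⟨ m+[n∸m]≡n (≮⇒≥ i≮2M) ⟩
    i ∎
    where open ≡-Reasoning

  left≤right-vertexAt : ∀ i → left (vertexAt i) ≤ right (vertexAt i)
  left≤right-vertexAt i with i <? M
  ... | yes _ = ≤-refl
  ... | no _ with i <? M + M
  ...   | yes _ = ≤-refl
  ...   | no i≮2M with i <? slots
  ...     | no _      = ≤-refl
  ...     | yes i<slots = ≤-trans (<⇒≤ (m<n*o⇒m/o<n (+-cancelˡ-< (M + M) _ _ shifted))) (m≤m+n M _)
    where
    shifted : M + M + (i ∸ (M + M)) < M + M + M * k
    shifted = subst₂ (λ a b → a < M + M + b) (sym (m+[n∸m]≡n (≮⇒≥ i≮2M))) (*-comm k M) i<slots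

  slot-Z<slots : ∀ {a t} → a < M → t < k → slot (Z a t) < slots
  slot-Z<slots {a} {t} a<M t<k = +-monoʳ-< (M + M) (begin-strict
    t + a * k       <⟨ +-monoˡ-< (a * k) t<k ⟩
    k + a * k       ≤⟨ *-monoˡ-≤ k a<M ⟩
    M * k           ≡⟨ *-comm M k ⟩
    k * M           ∎)
    where open ≤-Reasoning

  vertexAt-slot : ∀ v → Valid v → vertexAt (slot v) ≡ v
  vertexAt-slot (X x) x<M with x <? M
  ... | yes _   = refl
  ... | no x≮M  = ⊥-elim (x≮M (<-trans (n<1+n x) x<M))
  vertexAt-slot (Y y) (_ , y<M) with M + y <? M
  ... | yes M+y<M = ⊥-elim (m+n≮m M y M+y<M)
  ... | no _ with M + y <? M + M
  ...   | yes _     = cong Y (m+n∸m≡n M y)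
  ...   | no M+y≮2M = ⊥-elim (M+y≮2M (+-monoʳ-< M y<M))
  vertexAt-slot (Z a t) (a<M , t<k) with slot (Z a t) <? M
  ... | yes s<M = ⊥-elim (<⇒≱ s<M (≤-trans (m≤m+n M M) (m≤m+n (M + M) _)))
  ... | no _ with slot (Z a t) <? M + M
  ...   | yes s<2M = ⊥-elim (m+n≮m (M + M) _ s<2M)
  ...   | no _ with slot (Z a t) <? slots
  ...     | no s≮slots = ⊥-elim (s≮slots (slot-Z<slots a<M t<k))
  ...     | yes _ rewrite m+n∸m≡n (M + M) (t + a * k) = cong₂ Z quotient remainder
    where
    remainder : (t + a * k) % k ≡ t
    remainder = trans ([m+kn]%n≡m%n t a k) (m<n⇒m%n≡m t<k)
    quotient : (t + a * k) / k ≡ a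
    quotient = proj₂ (quotient-unique k ((t + a * k) / k) a t<k t<k (begin
      t + (t + a * k) / k * k                  ≡⟨ cong (_+ (t + a * k) / k * k) remainder ⟨
      (t + a * k) % k + (t + a * k) / k * k    ≡⟨ m≡m%n+[m/n]*n (t + a * k) k ⟨
      t + a * k                                ∎))
      where open ≡-Reasoning

  chosen : ℕ → Bool
  chosen i = does (valid? (vertexAt i))

  chosen-slot : ∀ {v} → Valid v → chosen (slot v) ≡ true
  chosen-slot {v} valid rewrite vertexAt-slot v valid = dec-true (valid? v) valid

  chosen⇒valid : ∀ {i} → chosen i ≡ true → Valid (vertexAt i)
  chosen⇒valid {i} eq with valid? (vertexAt i)
  ... | yes valid = valid

  open IntervalGraph (left ∘ vertexAt) (right ∘ vertexAt)

  record Meets (u w : Vertex) : Set where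
    constructor overlapping
    field
      left≤rightʳ : left u ≤ right w
      left≤rightˡ : left w ≤ right u

  data Misses (u w : Vertex) : Set where
    leftOf  : right w < left u → Misses u w
    rightOf : right u < left w → Misses u w

  Separates : Vertex → Vertex → Vertex → Set
  Separates u v w = (Meets u w × Misses v w) ⊎ (Misses u w × Meets v w)

  Distinguisher : Vertex → Vertex → Vertex → Set
  Distinguisher u v w = Valid w × w ≢ u × w ≢ v × Separates u v w

  record Separated (u v : Vertex) : Set where
    field
      witness    : ℕ → Vertex
      increasing : IncreasingBelow k (slot ∘ witness)
      good       : ∀ j → j < k → Distinguisher u v (witness j)

  Separated-sym : ∀ {u v} → Separated u v → Separated v u
  Separated-sym {u} {v} s = record { witness = witness ; increasing = increasing ; good = λ j j<k → swap (good j j<k) }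
    where
    open Separated s
    swap : ∀ {w} → Distinguisher u v w → Distinguisher v u w
    swap (valid , ≢u , ≢v , inj₁ (p , q)) = valid , ≢v , ≢u , inj₂ (q , p)
    swap (valid , ≢u , ≢v , inj₂ (p , q)) = valid , ≢v , ≢u , inj₁ (q , p)

  slot-injective : ∀ {u w} → Valid u → Valid w → slot u ≡ slot w → u ≡ w
  slot-injective {u} {w} vu vw eq = trans (sym (vertexAt-slot u vu)) (trans (cong vertexAt eq) (vertexAt-slot w vw))

  meets-slot : ∀ {u w} → Valid u → Valid w → u ≢ w → Meets u w → meets (slot u) (slot w) ≡ true
  meets-slot {u} {w} vu vw u≢w (overlapping p q) = meets-true (u≢w ∘ slot-injective vu vw)
    (subst₂ _≤_ (sym (cong left (vertexAt-slot u vu))) (sym (cong right (vertexAt-slot w vw))) p)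
    (subst₂ _≤_ (sym (cong left (vertexAt-slot w vw))) (sym (cong right (vertexAt-slot u vu))) q)

  misses-slot : ∀ {u w} → Valid u → Valid w → Misses u w → meets (slot u) (slot w) ≡ false
  misses-slot {u} {w} vu vw (leftOf p) = meets-false {slot u} {slot w}
    (inj₁ (subst₂ _<_ (sym (cong right (vertexAt-slot w vw))) (sym (cong left (vertexAt-slot u vu))) p))
  misses-slot {u} {w} vu vw (rightOf p) = meets-false {slot u} {slot w}
    (inj₂ (subst₂ _<_ (sym (cong right (vertexAt-slot u vu))) (sym (cong left (vertexAt-slot w vw))) p))

  distinguishes-slot : ∀ {u v w} → Valid u → Valid v → Distinguisher u v w →
                       distinguishes chosen (slot u) (slot v) (slot w) ≡ true
  distinguishes-slot {u} {v} {w} vu vv (vw , w≢u , w≢v , separates)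
    rewrite chosen-slot vw | ≢⇒≡ᵇ-false (w≢u ∘ slot-injective vw vu) | ≢⇒≡ᵇ-false (w≢v ∘ slot-injective vw vv)
    with separates
  ... | inj₁ (m , m′) rewrite meets-slot vu vw (w≢u ∘ sym) m | misses-slot vv vw m′ = refl
  ... | inj₂ (m , m′) rewrite misses-slot vu vw m | meets-slot vv vw (w≢v ∘ sym) m′ = refl

  Meets-XZ : ∀ {x a t} → x < M → a ≤ x → Meets (X x) (Z a t)
  Meets-XZ x<M a≤x = overlapping (≤-trans (<⇒≤ x<M) (m≤m+n M _)) a≤x

  Meets-ZX : ∀ {x a t} → x < M → a ≤ x → Meets (Z a t) (X x)
  Meets-ZX x<M a≤x = overlapping a≤x (≤-trans (<⇒≤ x<M) (m≤m+n M _))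

  Meets-YZ : ∀ {y a t} → a < M → y ≤ height a t → Meets (Y y) (Z a t)
  Meets-YZ {y} a<M y≤h = overlapping (+-monoʳ-≤ M y≤h) (≤-trans (<⇒≤ a<M) (m≤m+n M y))

  Meets-ZY : ∀ {y a t} → a < M → y ≤ height a t → Meets (Z a t) (Y y)
  Meets-ZY {y} a<M y≤h = overlapping (≤-trans (<⇒≤ a<M) (m≤m+n M y)) (+-monoʳ-≤ M y≤h)

  Meets-ZZ : ∀ {a t a' t'} → a < M → a' < M → Meets (Z a t) (Z a' t')
  Meets-ZZ a<M a'<M = overlapping (≤-trans (<⇒≤ a<M) (m≤m+n M _)) (≤-trans (<⇒≤ a'<M) (m≤m+n M _))

  Misses-YZ : ∀ {y a t} → height a t < y → Misses (Y y) (Z a t)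
  Misses-YZ h<y = leftOf (+-monoʳ-< M h<y)

  Misses-ZY : ∀ {y a t} → height a t < y → Misses (Z a t) (Y y)
  Misses-ZY h<y = rightOf (+-monoʳ-< M h<y)

  Misses-XY : ∀ {x y} → x < M → Misses (X x) (Y y)
  Misses-XY {y = y} x<M = rightOf (≤-trans x<M (m≤m+n M y))

  Misses-YX : ∀ {x y} → x < M → Misses (Y y) (X x)
  Misses-YX {y = y} x<M = leftOf (≤-trans x<M (m≤m+n M y))

  slot-Z-monoˡ : ∀ {a b} t → a < b → slot (Z a t) < slot (Z b t)
  slot-Z-monoˡ t a<b = +-monoʳ-< (M + M) (+-monoʳ-< t (*-monoˡ-< k a<b))

  slot-Z-monoʳ : ∀ a t → slot (Z a t) < slot (Z a (suc t))
  slot-Z-monoʳ a t = +-monoʳ-< (M + M) (n<1+n (t + a * k))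

  last<M : last < M
  last<M = n<1+n last

  offset<M : ∀ {u j} → u < N → j < k → u + j * N < M
  offset<M {u} {j} u<N j<k = <-≤-trans (+-monoˡ-< (j * N) u<N) (*-monoˡ-≤ N j<k)

  separated-XX : ∀ {x x'} → Valid (X x) → Valid (X x') → x < x' → Separated (X x) (X x')
  separated-XX {x} {x'} 1+x<M 1+x'<M x<x' = record
    { witness    = Z x'
    ; increasing = λ j _ → slot-Z-monoʳ x' j
    ; good       = λ j j<k → (x'<M , j<k) , (λ ()) , (λ ()) , inj₂ (rightOf x<x' , Meets-XZ x'<M ≤-refl)
    }
    where x'<M = <-trans (n<1+n x') 1+x'<M

  separated-YY : ∀ {y y'} → Valid (Y y) → Valid (Y y') → y < y' → Separated (Y y) (Y y')
  separated-YY {y} {y'} (_ , y<M) _ y<y' with height-attains y y<M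
  ... | u , t , u<N , t<k , height≡y = record
    { witness    = λ j → Z (u + j * N) t
    ; increasing = λ j _ → slot-Z-monoˡ t (+-monoʳ-< u (m<n+m (j * N) z<s))
    ; good       = λ j j<k → (offset<M u<N j<k , t<k) , (λ ()) , (λ ()) ,
        inj₁ (Meets-YZ (offset<M u<N j<k) (≤-reflexive (sym (height≡y j))) ,
              Misses-YZ (subst (_< y') (sym (height≡y j)) y<y'))
    }

  separated-XZ : ∀ {x a t} → Valid (X x) → Valid (Z a t) → Separated (X x) (Z a t)
  separated-XZ {x} {a} {t} 1+x<M (a<M , t<k) with k ≤? height a t
  ... | yes k≤h = record
    { witness    = λ j → Y (suc j)
    ; increasing = λ j _ → +-monoʳ-< M (n<1+n (suc j))
    ; good       = λ j j<k → (z<s , ≤-<-trans j<k k<M) , (λ ()) , (λ ()) ,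
        inj₂ (Misses-XY (<-trans (n<1+n x) 1+x<M) , Meets-ZY a<M (≤-trans j<k k≤h))
    }
  ... | no k≰h = record
    { witness    = Z last
    ; increasing = λ j _ → slot-Z-monoʳ last j
    ; good       = λ j j<k → (last<M , j<k) , (λ ()) , (λ { refl → k≰h (k≤height-last t) }) ,
        inj₂ (rightOf (≤-pred 1+x<M) , Meets-ZZ a<M last<M)
    }

  separated-YZ : ∀ {y a t} → Valid (Y y) → Valid (Z a t) → Separated (Y y) (Z a t)
  separated-YZ {y} {a} {t} (0<y , y<M) (a<M , t<k) with k + a ≤? last
  ... | yes k+a≤last = record
    { witness    = λ j → X (j + a)
    ; increasing = λ j _ → n<1+n (j + a)
    ; good       = λ j j<k → let 1+j+a<M = ≤-<-trans (≤-trans (+-monoˡ-≤ a j<k) k+a≤last) last<M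
                                 j+a<M   = <-trans (n<1+n (j + a)) 1+j+a<M in
        1+j+a<M , (λ ()) , (λ ()) , inj₂ (Misses-YX j+a<M , Meets-ZX j+a<M (m≤n+m a j))
    }
  ... | no k+a≰last = record
    { witness    = λ j → Z (j * N) 0
    ; increasing = λ j _ → slot-Z-monoˡ 0 (m<n+m (j * N) {N} z<s)
    ; good       = λ j j<k → (offset<M z<s j<k , z<s) , (λ ()) ,
        (λ { refl → <-irrefl refl (≤-<-trans (*-monoˡ-≤ N (≤-pred j<k)) high) }) ,
        inj₂ (Misses-YZ (subst (_< y) (sym (height-multiple j)) 0<y) , Meets-ZZ a<M (offset<M z<s j<k))
    }
    where
    high : suc k₂ * N < a
    high = +-cancelʳ-< k _ _ (begin-strict
      suc k₂ * N + k   <⟨ +-monoʳ-< (suc k₂ * N) k<N ⟩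
      suc k₂ * N + N   ≡⟨ +-comm (suc k₂ * N) N ⟩
      M                ≤⟨ ≰⇒> k+a≰last ⟩
      k + a            ≡⟨ +-comm k a ⟩
      a + k            ∎)
      where open ≤-Reasoning

  Straddles : ℕ → ℕ → ℕ → ℕ → Set
  Straddles x y a t = a ≤ x × height a t < y ⊎ x < a × y ≤ height a t

  separated-XY-by : ∀ {x y} → Valid (X x) → (a t : ℕ → ℕ) → IncreasingBelow k (λ j → slot (Z (a j) (t j))) →
    (∀ j → j < k → a j < M × t j < k × Straddles x y (a j) (t j)) → Separated (X x) (Y y)
  separated-XY-by {x} {y} 1+x<M a t increasing good = record
    { witness    = λ j → Z (a j) (t j)
    ; increasing = increasing
    ; good       = λ j j<k → let (a<M , t<k , straddles) = good j j<k in
                             (a<M , t<k) , (λ ()) , (λ ()) , separates a<M straddles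
    }
    where
    separates : ∀ {a t} → a < M → Straddles x y a t → Separates (X x) (Y y) (Z a t)
    separates a<M (inj₁ (a≤x , h<y)) = inj₁ (Meets-XZ (<-trans (n<1+n x) 1+x<M) a≤x , Misses-YZ h<y)
    separates a<M (inj₂ (x<a , y≤h)) = inj₂ (rightOf x<a , Meets-YZ a<M y≤h)

  separated-XY-low : ∀ {x y} → Valid (X x) → Valid (Y y) → y ≤ suc k₂ * N → Separated (X x) (Y y)
  separated-XY-low {x} {y} 1+x<M (0<y , _) y≤top with k + x ≤? last
  ... | yes k+x≤last = separated-XY-by 1+x<M (λ j → j + suc x) (λ _ → suc k₂)
    (λ j _ → slot-Z-monoˡ (suc k₂) (n<1+n (j + suc x)))
    λ j j<k → ≤-<-trans (≤-trans (≤-reflexive (+-suc j x)) (≤-trans (+-monoˡ-≤ x j<k) k+x≤last)) last<M ,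
              n<1+n (suc k₂) , inj₂ (m≤n+m (suc x) j , ≤-trans y≤top (height-top (j + suc x)))
  ... | no k+x≰last = separated-XY-by 1+x<M (λ j → j * N) (λ _ → 0)
    (λ j _ → slot-Z-monoˡ 0 (m<n+m (j * N) {N} z<s))
    λ j j<k → offset<M z<s j<k , z<s ,
              inj₁ (≤-trans (*-monoˡ-≤ N (≤-pred j<k)) wide , subst (_< y) (sym (height-multiple j)) 0<y)
    where
    wide : suc k₂ * N ≤ x
    wide = +-cancelˡ-≤ k _ _ (≤-trans (+-monoˡ-≤ (suc k₂ * N) (<⇒≤ k<N)) (≰⇒> k+x≰last))

  separated-XY-high : ∀ {x y} → Valid (X x) → Valid (Y y) → suc k₂ * N < y → Separated (X x) (Y y)
  separated-XY-high {x} {y} 1+x<M (_ , y<M) top<y with suc k₂ ≤? x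
  ... | yes 1+k₂≤x = separated-XY-by 1+x<M (λ j → j + (x ∸ suc k₂)) (λ _ → 0)
    (λ j _ → slot-Z-monoˡ 0 (n<1+n (j + (x ∸ suc k₂))))
    λ j j<k → let a≤x = ≤-trans (+-monoˡ-≤ (x ∸ suc k₂) (≤-pred j<k)) (≤-reflexive (m+[n∸m]≡n 1+k₂≤x)) in
              ≤-<-trans a≤x (<-trans (n<1+n x) 1+x<M) , z<s , inj₁ (a≤x , height-0< (j + (x ∸ suc k₂)) top<y)
  ... | no 1+k₂≰x with height-attains y y<M
  ...   | u , t , u<N , t<k , height≡y = separated-XY-by 1+x<M start level increasing good
    where
    start level : ℕ → ℕ
    start zero    = x
    start (suc j) = u + suc j * N
    level zero    = 0
    level (suc j) = t
    x<N : x < N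
    x<N = <-trans (≰⇒> 1+k₂≰x) (<-trans (n<1+n (suc k₂)) k<N)
    N≤start : ∀ j → N ≤ u + suc j * N
    N≤start j = ≤-trans (m≤m+n N (j * N)) (m≤n+m (suc j * N) u)
    increasing : IncreasingBelow k (λ j → slot (Z (start j) (level j)))
    increasing zero    _ = +-monoʳ-< (M + M) (≤-trans (*-monoˡ-< k (<-≤-trans x<N (N≤start 0))) (m≤n+m _ t))
    increasing (suc j) _ = slot-Z-monoˡ t (+-monoʳ-< u (m<n+m (suc j * N) {N} z<s))
    good : ∀ j → j < k → start j < M × level j < k × Straddles x y (start j) (level j)
    good zero    _   = <-trans (n<1+n x) 1+x<M , z<s , inj₁ (≤-refl , height-0< x top<y)
    good (suc j) j<k = offset<M u<N j<k , t<k ,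
      inj₂ (<-≤-trans x<N (N≤start j) , ≤-reflexive (sym (height≡y (suc j))))

  separated-XY : ∀ {x y} → Valid (X x) → Valid (Y y) → Separated (X x) (Y y)
  separated-XY {y = y} vx vy with y ≤? suc k₂ * N
  ... | yes y≤top = separated-XY-low vx vy y≤top
  ... | no y≰top  = separated-XY-high vx vy (≰⇒> y≰top)

  staircase : ℕ → ℕ → ℕ → ℕ → Vertex
  staircase a d ylo j with j <? d
  ... | yes _ = X (a + j)
  ... | no _  = Y (ylo + suc (j ∸ d))

  separated-by-staircase : ∀ {a₁ t₁ a₂ t₂} a d ylo e → k ≤ d + e → a + d < M → ylo + e < M →
     (∀ j → j < d → Separates (Z a₁ t₁) (Z a₂ t₂) (X (a + j))) →
     (∀ i → ylo < i → i ≤ ylo + e → Separates (Z a₁ t₁) (Z a₂ t₂) (Y i)) →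
     Separated (Z a₁ t₁) (Z a₂ t₂)
  separated-by-staircase {a₁} {t₁} {a₂} {t₂} a d ylo e k≤d+e a+d<M ylo+e<M onX onY = record
    { witness = staircase a d ylo ; increasing = increasing ; good = good }
    where
    increasing : IncreasingBelow k (slot ∘ staircase a d ylo)
    increasing j _ with j <? d | suc j <? d
    ... | yes _   | yes _     = +-monoʳ-< a (n<1+n j)
    ... | yes j<d | no _      = <-≤-trans (<-trans (+-monoʳ-< a j<d) a+d<M) (m≤m+n M _)
    ... | no j≮d  | yes 1+j<d = ⊥-elim (j≮d (<-trans (n<1+n j) 1+j<d))
    ... | no j≮d  | no _      = +-monoʳ-< M (+-monoʳ-< ylo (s≤s (≤-reflexive (sym (+-∸-assoc 1 (≮⇒≥ j≮d))))))
    good : ∀ j → j < k → Distinguisher (Z a₁ t₁) (Z a₂ t₂) (staircase a d ylo j)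
    good j j<k with j <? d
    ... | yes j<d = subst (_< M) (+-suc a j) (≤-<-trans (+-monoʳ-≤ a j<d) a+d<M) , (λ ()) , (λ ()) , onX j j<d
    ... | no j≮d  = (≤-trans (s≤s z≤n) (m≤n+m (suc (j ∸ d)) ylo) , ≤-<-trans i≤ylo+e ylo+e<M) ,
                    (λ ()) , (λ ()) , onY i (m<m+n ylo z<s) i≤ylo+e
      where
      i = ylo + suc (j ∸ d)
      i≤ylo+e : i ≤ ylo + e
      i≤ylo+e = +-monoʳ-≤ ylo (+-cancelˡ-< d _ _
        (subst (_< d + e) (sym (m+[n∸m]≡n (≮⇒≥ j≮d))) (<-≤-trans j<k k≤d+e)))

  separated-ZZ : ∀ {a t a' t'} d → a + d ≡ a' → Valid (Z a t) → Valid (Z a' t') → Z a t ≢ Z a' t' →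
                 Separated (Z a t) (Z a' t')
  separated-ZZ {a} {t} {_} {t'} d refl (a<M , t<k) (a+d<M , t'<k) different with height a t ≤? height (a + d) t'
  ... | yes h≤h' = separated-by-staircase a d (height a t) (height (a + d) t' ∸ height a t)
    (far-above a d (λ (d≡0 , t≡t') → different (cong₂ Z (sym (trans (cong (a +_) d≡0) (+-identityʳ a))) t≡t'))
               h≤h')
    a+d<M (subst (_< M) (sym (m+[n∸m]≡n h≤h')) (height<M (a + d) t'<k))
    (λ j j<d → inj₁ (Meets-ZX (<-trans (+-monoʳ-< a j<d) a+d<M) (m≤m+n a j) , leftOf (+-monoʳ-< a j<d)))
    (λ i h<i i≤ → inj₂ (Misses-ZY h<i , Meets-ZY a+d<M (subst (i ≤_) (m+[n∸m]≡n h≤h') i≤)))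
  ... | no h≰h' = separated-by-staircase a d (height (a + d) t') (height a t ∸ height (a + d) t')
    (far-below a d {t} {t'} h'<h)
    a+d<M (subst (_< M) (sym (m+[n∸m]≡n (<⇒≤ h'<h))) (height<M a t<k))
    (λ j j<d → inj₁ (Meets-ZX (<-trans (+-monoʳ-< a j<d) a+d<M) (m≤m+n a j) , leftOf (+-monoʳ-< a j<d)))
    (λ i h'<i i≤ → inj₁ (Meets-ZY a<M (subst (i ≤_) (m+[n∸m]≡n (<⇒≤ h'<h)) i≤) , Misses-ZY h'<i))
    where
    h'<h = ≰⇒> h≰h'

  separated : ∀ {u v} → Valid u → Valid v → u ≢ v → Separated u v
  separated {X x} {X x'} vu vv u≢v with <-cmp x x'
  ... | tri< x<x' _ _ = separated-XX vu vv x<x'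
  ... | tri≈ _ x≡x' _ = ⊥-elim (u≢v (cong X x≡x'))
  ... | tri> _ _ x'<x = Separated-sym (separated-XX vv vu x'<x)
  separated {Y y} {Y y'} vu vv u≢v with <-cmp y y'
  ... | tri< y<y' _ _ = separated-YY vu vv y<y'
  ... | tri≈ _ y≡y' _ = ⊥-elim (u≢v (cong Y y≡y'))
  ... | tri> _ _ y'<y = Separated-sym (separated-YY vv vu y'<y)
  separated {Z a t} {Z a' t'} vu vv u≢v with a ≤? a'
  ... | yes a≤a' = separated-ZZ (a' ∸ a) (m+[n∸m]≡n a≤a') vu vv u≢v
  ... | no a≰a'  = Separated-sym (separated-ZZ (a ∸ a') (m+[n∸m]≡n (<⇒≤ (≰⇒> a≰a'))) vv vu (u≢v ∘ sym))
  separated {X _}   {Y _}   vu vv _ = separated-XY vu vv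
  separated {X _}   {Z _ _} vu vv _ = separated-XZ vu vv
  separated {Y _}   {Z _ _} vu vv _ = separated-YZ vu vv
  separated {Y _}   {X _}   vu vv _ = Separated-sym (separated-XY vv vu)
  separated {Z _ _} {X _}   vu vv _ = Separated-sym (separated-XZ vv vu)
  separated {Z _ _} {Y _}   vu vv _ = Separated-sym (separated-YZ vv vu)

  slot<slots : ∀ {v} → Valid v → slot v < slots
  slot<slots {X x}   1+x<M       = <-≤-trans (<-trans (n<1+n x) 1+x<M) (≤-trans (m≤m+n M M) (m≤m+n (M + M) (k * M)))
  slot<slots {Y y}   (_ , y<M)   = <-≤-trans (+-monoʳ-< M y<M) (m≤m+n (M + M) (k * M))
  slot<slots {Z a t} (a<M , t<k) = slot-Z<slots a<M t<k

  k≤sd : ∀ n → slots ≤ n → k ≤ sd (graph n)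
  k≤sd n slots≤n = sd-≥ (graph n) S k 2≤|S| (≤-trans (slot<slots {X (suc k₂)} k<M) slots≤n) separated-pair
    where
    S = Vec.tabulate (chosen ∘ toℕ)
    chosen-lookup : ∀ {u} → lookup S u ≡ true → Valid (vertexAt (toℕ u))
    chosen-lookup {u} Su = chosen⇒valid {toℕ u} (trans (sym (lookup∘tabulate (chosen ∘ toℕ) u)) Su)
    2≤|S| : 2 ≤ size S
    2≤|S| = subst (2 ≤_) (count-cong {n} (sym ∘ lookup∘tabulate (chosen ∘ toℕ)))
      (count-≥ 2 n chosen (λ j → j) (λ j _ → n<1+n j) λ j j<2 →
        let 1+j<M = ≤-<-trans j<2 (≤-<-trans (s≤s (s≤s z≤n)) k<M) in
        <-≤-trans (slot<slots {X j} 1+j<M) slots≤n , chosen-slot {X j} 1+j<M)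
    separated-pair : ∀ u v → lookup S u ≡ true → lookup S v ≡ true → u ≢ v → k ≤ sdIn (graph n) S u v
    separated-pair u v Su Sv u≢v = subst (k ≤_) (sym (sdIn-graph chosen u v))
      (count-≥ k n (distinguishes chosen (toℕ u) (toℕ v)) (slot ∘ witness) increasing hits)
      where
      vu = chosen-lookup Su
      vv = chosen-lookup Sv
      open Separated (separated vu vv λ eq → u≢v (toℕ-injective
        (trans (sym (slot-vertexAt (toℕ u))) (trans (cong slot eq) (slot-vertexAt (toℕ v))))))
      hits : ∀ j → j < k → slot (witness j) < n × distinguishes chosen (toℕ u) (toℕ v) (slot (witness j)) ≡ true
      hits j j<k = <-≤-trans (slot<slots (proj₁ (good j j<k))) slots≤n ,
        subst₂ (λ i i′ → distinguishes chosen i i′ (slot (witness j)) ≡ true)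
          (slot-vertexAt (toℕ u)) (slot-vertexAt (toℕ v)) (distinguishes-slot vu vv (good j j<k))

  construction : ∀ n → slots ≤ n → Σ (Graph n) λ G → IsIntervalGraph G × k ≤ sd G
  construction n slots≤n = graph n , graph-isInterval left≤right-vertexAt n , k≤sd n slots≤n

open Construction using (slots; construction)

bracket : ∀ (f : ℕ → ℕ) → (∀ x → f x < f (suc x)) →
          ∀ n → f 0 ≤ n → Σ ℕ λ x → f x ≤ n × n < f (suc x)
bracket f f-inc zero    f0≤0 = 0 , f0≤0 , ≤-<-trans z≤n (f-inc 0)
bracket f f-inc (suc n) f0≤1+n with f 0 ≤? n
... | no  f0≰n = 0 , f0≤1+n , subst (_< f 1) (≤-antisym f0≤1+n (≰⇒> f0≰n)) (f-inc 0)
... | yes f0≤n with bracket f f-inc n f0≤n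
...   | x , fx≤n , n<fx' with suc n <? f (suc x)
...     | yes 1+n<fx' = x , m≤n⇒m≤1+n fx≤n , 1+n<fx'
...     | no  1+n≮fx' = suc x , ≤-reflexive fx'≡1+n , subst (_< f (suc (suc x))) fx'≡1+n (f-inc (suc x))
  where
  fx'≡1+n : f (suc x) ≡ suc n
  fx'≡1+n = ≤-antisym (≮⇒≥ 1+n≮fx') n<fx'

slots-increasing : ∀ x → slots x < slots (suc x)
slots-increasing x = +-mono-< (+-mono-< M<M′ M<M′) (*-mono-< k<k′ M<M′)
  where
  k<k′ : 2 + x < 3 + x
  k<k′ = n<1+n (2 + x)
  M<M′ : Construction.M x < Construction.M (suc x)
  M<M′ = *-mono-< k<k′ (s≤s (*-mono-< k<k′ k<k′))

slots-bound : ∀ x → slots (suc x) ≤ (3 * (2 + x)) ^ 4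
slots-bound x = subst (slots (suc x) ≤_) (expand x) (m≤m+n (slots (suc x)) _)
  where
  expand : ∀ x → let k = 3 + x ; M = k * suc (k * k) in
    M + M + k * M + (80 * (x * x * x * x) + 634 * (x * x * x) + 1871 * (x * x) + 2422 * x + 1146)
      ≡ 3 * (2 + x) * (3 * (2 + x) * (3 * (2 + x) * (3 * (2 + x) * 1)))
  expand = solve-∀

theorem7 : Σ ℕ λ d → Σ ℕ λ N → (n : ℕ) → N ≤ n →
    Σ (Graph n) λ G → IsIntervalGraph G × (n ≤ (suc d * sd G) ^ 4)
theorem7 = 2 , slots 0 , λ n slots₀≤n →
  let (x , slots≤n , n<slots′) = bracket slots slots-increasing n slots₀≤n
      (G , interval , k≤sd) = construction x n slots≤n
  in G , interval , (begin
    n                      ≤⟨ <⇒≤ n<slots′ ⟩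
    slots (suc x)          ≤⟨ slots-bound x ⟩
    (3 * (2 + x)) ^ 4      ≤⟨ ^-monoˡ-≤ 4 (*-monoʳ-≤ 3 k≤sd) ⟩
    (3 * sd G) ^ 4         ∎)
  where open ≤-Reasoning
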